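{- Let $F$ be a CNF formula, $(T,\delta)$ a decomposition tree of $I(F)$, and let $x,y,z$ be nodes of $T$ such that $x$ and $y$ are the children of $z$. Let $l_x$ and $l_y$ be lower bounding functions for $x$ and $y$, respectively. Define $l_z$ on $\mathcal{R}_z$ by $$l_z(s)=\sum_{(s_x,s_y)\in\mathrm{RGen}_z(s)} l_x(s_x)\,l_y(s_y)\qquad(s\in\mathcal{R}_z).$$ Then $l_z$ is a lower bounding function for $z$.
   Context: A clause is a finite set of literals (variables $x$ or negations $\bar x$) not containing both $x$ and $\bar x$; a CNF formula $F$ is a finite set of clauses; $\mathrm{var}(C)$, $\mathrm{var}(F)$ denote occurring variables. The incidence graph $I(F)$ has vertex set $\mathrm{var}(F)\cup F$ and edges $Cx$ for $x\in\mathrm{var}(C)$. A decomposition tree of a graph is a pair $(T,\delta)$ with $T$ a rooted binary tree and $\delta$ a bijection from the leaves of $T$ to the vertex set. For a set of variables $X$, $2^X$ is the set of maps $\sigma:X\to\{0,1\}$ ($\sigma(\bar x)=1-\sigma(x)$); $\sigma$ satisfies $C$ if $\sigma(\ell)=1$ for some $\ell\in C$ with variable in $X$. For a set of clauses $G$, $G(\sigma)$ is the set of clauses of $G$ satisfied by $\sigma$, $\mathrm{Proj}(G,X)=\{G(\sigma):\sigma\in2^X\}$, and $G^{\supseteq X}=\{C\in G: X\subseteq\mathrm{var}(C)\}$. For a node $z$ of $T$ let $T_z$ be the subtree rooted at $z$ with leaf set $L(T_z)$; $\mathrm{var}_z=\mathrm{var}(F)\cap\delta(L(T_z))$, $F_z=F\cap\delta(L(T_z))$,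 $\overline{F_z}=F\setminus F_z$, $\overline{\mathrm{var}_z}=\mathrm{var}(F)\setminus\mathrm{var}_z$. A shape for $z$ is a pair $(\mathit{out},\mathit{in})$ with $\mathit{out}\subseteq\overline{F_z}$, $\mathit{in}\subseteq F_z$; $\mathcal{S}_z$ is the set of shapes for $z$. An assignment $\tau\in2^{\mathrm{var}_z}$ is of shape $(\mathit{out},\mathit{in})$ if (i) $\overline{F_z}(\tau)=\mathit{out}$ and (ii) every $C\in F_z$ is satisfied by $\tau$ or belongs to $\mathit{in}$; $n_z(s)$ is the number of assignments in $2^{\mathrm{var}_z}$ of shape $s$. A shape is proper if $\mathit{out}\in\mathrm{Proj}(\overline{F_z},\mathrm{var}_z)$ and $\mathit{in}\in\mathrm{Proj}(F_z,\overline{\mathrm{var}_z})$. If $x,y$ are the children of $z$, shapes $(\mathit{out}_x,\mathit{in}_x)\in\mathcal{S}_x$, $(\mathit{out}_y,\mathit{in}_y)\in\mathcal{S}_y$ generate $(\mathit{out}_z,\mathit{in}_z)\in\mathcal{S}_z$ if (1) $\mathit{out}_z=(\mathit{out}_x\cup\mathit{out}_y)\cap\overline{F_z}$, (2) $\mathit{in}_x=(\mathit{in}_z\cup\mathit{out}_y)\cap F_x$, (3) $\mathit{in}_y=(\mathit{in}_z\cup\mathit{out}_x)\cap F_y$; $\mathrm{Gen}_z(s)$ is the set of pairs in $\mathcal{S}_x\times\mathcal{S}_y$ generating $s$. Let $\mathcal{X}^{\uparrow}_z=\{X\subseteq\mathrm{var}_z:\exists C\in\overline{F_z},\ X=\mathrm{var}_z\cap\mathrm{var}(C)\}$,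 $\mathcal{X}^{\downarrow}_z=\{X\subseteq\overline{\mathrm{var}_z}:\exists C\in F_z,\ X=\overline{\mathrm{var}_z}\cap\mathrm{var}(C)\}$; $\Phi_z$ is the set of functions $f$ on $\mathcal{X}^{\uparrow}_z$ with $f(X)\in\mathrm{Proj}(\overline{F_z}^{\supseteq X},X)$, $\Psi_z$ the set of functions $g$ on $\mathcal{X}^{\downarrow}_z$ with $g(Y)\in\mathrm{Proj}(F_z^{\supseteq Y},Y)$, $\mathrm{union}(h)=\bigcup_{X\in\mathrm{dom}(h)}h(X)$, and $\mathcal{R}_z=\{(\mathit{out},\mathit{in})\in\mathcal{S}_z:\exists f\in\Phi_z,\ \mathit{out}=\mathrm{union}(f),\ \exists g\in\Psi_z,\ \mathit{in}=\mathrm{union}(g)\}$. $\mathrm{RGen}_z(s)=\mathrm{Gen}_z(s)\cap(\mathcal{R}_x\times\mathcal{R}_y)$. A lower bounding function for $z$ assigns to each $s\in\mathcal{R}_z$ a value $l_z(s)$ with $l_z(s)\le n_z(s)$, and $l_z(s)=n_z(s)$ whenever $s$ is proper. -}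

module Defs where

open import Data.Nat using (ℕ; zero; suc; _+_; _*_; _≤_)
open import Data.Fin using (Fin)
open import Data.Fin.Subset using (Subset) renaming (_∈_ to _∈ˢ_)
open import Data.Bool using (Bool; true; false)
open import Data.Maybe using (Maybe; just; nothing)
open import Data.Vec using (Vec; []; _∷_; lookup)
open import Data.List using (List; []; _∷_; _++_; map; concatMap; [_])
open import Data.List.Membership.Propositional using () renaming (_∈_ to _∈ₗ_)
open import Data.List.Relation.Unary.Unique.Propositional using (Unique)
open import Data.Sum using (_⊎_; inj₁; inj₂)
open import Data.Product using (_×_; _,_; proj₁; proj₂; ∃; ∃-syntax; Σ)
open import Relation.Nullary using (¬_)
open import Data.Unit using (⊤)
open import Relation.Binary.PropositionalEquality using (_≡_)
open import Function.Bundles using (_⇔_)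

allVec : {A : Set} → List A → (n : ℕ) → List (Vec A n)
allVec xs zero    = [ [] ]
allVec xs (suc n) = concatMap (λ a → map (a ∷_) (allVec xs n)) xs

allPairs : {A B : Set} → List A → List B → List (A × B)
allPairs as bs = concatMap (λ a → map (a ,_) bs) as

data SumOver {A : Set} (P : A → Set) (f : A → ℕ) : List A → ℕ → Set where
  []   : SumOver P f [] 0
  take : ∀ {a as r} → P a   → SumOver P f as r → SumOver P f (a ∷ as) (f a + r)
  skip : ∀ {a as r} → ¬ P a → SumOver P f as r → SumOver P f (a ∷ as) r

-- Variables are Fin n, a clause is a vector C : Vec (Maybe Bool) n with
-- lookup C v = just true  (literal v in C), just false (literal v̄ in C),
-- nothing (v does not occur).  This encodes exactly the finite sets of
-- literals not containing both x and x̄.  A formula is a finite SET of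
-- clauses, given by an injective indexing Fin m → Clause n.

Clause : ℕ → Set
Clause n = Vec (Maybe Bool) n

record CNF : Set where
  field
    n      : ℕ
    m      : ℕ
    clause : Fin m → Clause n
    clause-injective : ∀ {i j} → clause i ≡ clause j → i ≡ j

_∈var_ : {n : ℕ} → Fin n → Clause n → Set
v ∈var C = ∃[ b ] (lookup C v ≡ just b)

-- partial assignments: σ ∈ 2^X is encoded as the vector with
-- lookup σ v = just σ(v) for v ∈ X and nothing for v ∉ X
PAssign : ℕ → Set
PAssign n = Vec (Maybe Bool) n

IsAssignOn : {n : ℕ} → (Fin n → Set) → PAssign n → Set
IsAssignOn X σ = ∀ v → (X v → ∃[ b ] (lookup σ v ≡ just b)) × (¬ X v → lookup σ v ≡ nothing)

Sat : {n : ℕ} → PAssign n → Clause n → Set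
Sat σ C = ∃[ v ] ∃[ b ] (lookup C v ≡ just b × lookup σ v ≡ just b)

allMaybeBool : List (Maybe Bool)
allMaybeBool = nothing ∷ just false ∷ just true ∷ []

allPAssign : (n : ℕ) → List (PAssign n)
allPAssign n = allVec allMaybeBool n

allSubsets : (m : ℕ) → List (Subset m)
allSubsets m = allVec (false ∷ true ∷ []) m

-- rooted binary trees whose leaves are labelled (the labelling is δ)
data BTree (A : Set) : Set where
  leaf : A → BTree A
  node : BTree A → BTree A → BTree A

leaves : {A : Set} → BTree A → List A
leaves (leaf a)   = a ∷ []
leaves (node l r) = leaves l ++ leaves r

-- t is a node of T (T_t is the subtree of T rooted at it)
data _⊑_ {A : Set} : BTree A → BTree A → Set where
  here  : ∀ {t} → t ⊑ t
  left  : ∀ {t l r} → t ⊑ l → t ⊑ node l r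
  right : ∀ {t l r} → t ⊑ r → t ⊑ node l r

module _ (F : CNF) where
  open CNF F

  VarF : Fin n → Set
  VarF v = ∃[ c ] (v ∈var clause c)

  Vertex : Set
  Vertex = Fin n ⊎ Fin m

  IsVertex : Vertex → Set
  IsVertex (inj₁ v) = VarF v
  IsVertex (inj₂ c) = ⊤

  IncEdge : Fin m → Fin n → Set
  IncEdge c v = v ∈var clause c

  Tree : Set
  Tree = BTree Vertex

  -- (T, δ) is a decomposition tree of I(F): δ (leaf labelling) is a
  -- bijection from the leaves of T onto the vertex set var(F) ∪ F
  IsDecompTree : Tree → Set
  IsDecompTree T = Unique (leaves T) × (∀ w → (w ∈ₗ leaves T ⇔ IsVertex w))

  InVar : Tree → Fin n → Set
  InVar z v = inj₁ v ∈ₗ leaves z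

  InF : Tree → Fin m → Set
  InF z c = inj₂ c ∈ₗ leaves z

  InVarC : Tree → Fin n → Set
  InVarC z v = VarF v × ¬ InVar z v

  InFC : Tree → Fin m → Set
  InFC z c = ¬ InF z c

  SatSetIs : (Fin m → Set) → PAssign n → Subset m → Set
  SatSetIs G σ S = ∀ c → (c ∈ˢ S ⇔ (G c × Sat σ (clause c)))

  InProj : (Fin m → Set) → (Fin n → Set) → Subset m → Set
  InProj G X S = ∃[ σ ] (IsAssignOn X σ × SatSetIs G σ S)

  Shape : Set
  Shape = Subset m × Subset m

  allShapes : List Shape
  allShapes = allPairs (allSubsets m) (allSubsets m)

  allShapePairs : List (Shape × Shape)
  allShapePairs = allPairs allShapes allShapes

  IsShape : Tree → Shape → Set
  IsShape z (out , inn) = (∀ c → c ∈ˢ out → InFC z c) × (∀ c → c ∈ˢ inn → InF z c)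

  OfShape : Tree → Shape → PAssign n → Set
  OfShape z (out , inn) τ =
    IsAssignOn (InVar z) τ × SatSetIs (InFC z) τ out
    × (∀ c → InF z c → Sat τ (clause c) ⊎ c ∈ˢ inn)

  NCount : Tree → Shape → ℕ → Set
  NCount z s k = SumOver (OfShape z s) (λ _ → 1) (allPAssign n) k

  Proper : Tree → Shape → Set
  Proper z (out , inn) = InProj (InFC z) (InVar z) out × InProj (InF z) (InVarC z) inn

  Gen : Tree → Tree → Tree → Shape → Shape × Shape → Set
  Gen z x y (outz , inz) ((outx , inx) , (outy , iny)) =
    IsShape x (outx , inx) × IsShape y (outy , iny)
    × (∀ c → (c ∈ˢ outz ⇔ ((c ∈ˢ outx ⊎ c ∈ˢ outy) × InFC z c)))
    × (∀ c → (c ∈ˢ inx ⇔ ((c ∈ˢ inz ⊎ c ∈ˢ outy) × InF x c)))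
    × (∀ c → (c ∈ˢ iny ⇔ ((c ∈ˢ inz ⊎ c ∈ˢ outx) × InF y c)))

  InXUp : Tree → Subset n → Set
  InXUp z X = ∃[ c ] (InFC z c × (∀ v → (v ∈ˢ X ⇔ (InVar z v × v ∈var clause c))))

  InXDown : Tree → Subset n → Set
  InXDown z Y = ∃[ c ] (InF z c × (∀ v → (v ∈ˢ Y ⇔ (InVarC z v × v ∈var clause c))))

  Sup : (Fin m → Set) → Subset n → Fin m → Set
  Sup G X c = G c × (∀ v → v ∈ˢ X → v ∈var clause c)

  -- f ∈ Φ_z (f is given on all of Subset n; only its restriction to 𝒳↑_z matters)
  InΦ : Tree → (Subset n → Subset m) → Set
  InΦ z f = ∀ X → InXUp z X → InProj (Sup (InFC z) X) (λ v → v ∈ˢ X) (f X)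

  InΨ : Tree → (Subset n → Subset m) → Set
  InΨ z g = ∀ Y → InXDown z Y → InProj (Sup (InF z) Y) (λ v → v ∈ˢ Y) (g Y)

  IsUnion : (Subset n → Set) → (Subset n → Subset m) → Subset m → Set
  IsUnion D h S = ∀ c → (c ∈ˢ S ⇔ (∃[ X ] (D X × c ∈ˢ h X)))

  InR : Tree → Shape → Set
  InR z (out , inn) =
    IsShape z (out , inn)
    × (∃[ f ] (InΦ z f × IsUnion (InXUp z) f out))
    × (∃[ g ] (InΨ z g × IsUnion (InXDown z) g inn))

  InRGen : Tree → Tree → Tree → Shape → Shape × Shape → Set
  InRGen z x y s p = Gen z x y s p × InR x (proj₁ p) × InR y (proj₂ p)

  -- l is a lower bounding function for z (l is defined on all shapes,
  -- only its values on ℛ_z are constrained)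
  LowerBounding : Tree → (Shape → ℕ) → Set
  LowerBounding z l =
    ∀ s → InR z s →
      (∀ k → NCount z s k → l s ≤ k) × (Proper z s → ∀ k → NCount z s k → l s ≡ k)

-- Restricting an assignment of var_z to var_x and to var_y is a bijection between the assignments of
-- shape s and the triples (generating pair (s_x , s_y), assignment of shape s_x, assignment of shape s_y),
-- so n_z(s) = Σ_{Gen_z(s)} n_x(s_x) n_y(s_y), and l_z(s) ≤ n_z(s) term by term. If s is proper, then in
-- every generating pair with n_x(s_x) n_y(s_y) ≠ 0 both shapes are proper (they are realised by
-- restrictions of the realisers of s and of the counted assignments); proper shapes lie in ℛ and there
-- l_x, l_y are exact, so the sum over RGen_z(s) misses only zero terms and equals n_z(s).

module Submission where

open import Defs
open import Data.Bool using (Bool; true; false; if_then_else_)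
open import Data.Bool.Properties using (T-≡)
open import Data.Empty using (⊥; ⊥-elim)
open import Data.Fin using (Fin)
open import Data.Fin.Properties using (all?; any?)
open import Data.Fin.Subset using (Subset) renaming (_∈_ to _∈ˢ_)
open import Data.Fin.Subset.Properties using (⊆-antisym) renaming (_∈?_ to _∈ˢ?_)
open import Data.List using (List; []; _∷_; _++_; map; concatMap; cartesianProductWith)
open import Data.List.Membership.Propositional using (_─_) renaming (_∈_ to _∈ₗ_)
open import Data.List.Membership.Propositional.Properties
  using (∈-++⁺ˡ; ∈-++⁺ʳ; ∈-++⁻; ∈-cartesianProductWith⁺)
open import Data.List.Relation.Unary.All as All using ([]; _∷_)
open import Data.List.Relation.Unary.All.Properties using (++⁻ˡ; ++⁻ʳ)
open import Data.List.Relation.Unary.AllPairs using ([]; _∷_)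
open import Data.List.Relation.Unary.Any using (here; there)
open import Data.List.Relation.Unary.Unique.Propositional using (Unique)
open import Data.List.Relation.Unary.Unique.Propositional.Properties using (cartesianProductWith⁺)
open import Data.Maybe using (Maybe; just; nothing)
import Data.Maybe.Properties as Maybe
import Data.Bool.Properties as Bool
open import Data.Nat using (ℕ; zero; suc; _+_; _*_; _≤_; z≤n; s≤s; _≟_)
open import Data.Nat.Properties
  using (+-assoc; +-mono-≤; m≤n+m; ≤-trans; ≤-antisym; *-mono-≤; *-zeroʳ; n≤0⇒n≡0)
open import Data.Product using (_×_; _,_; proj₁; proj₂; ∃; ∃-syntax; uncurry)
open import Data.Sum using (_⊎_; inj₁; inj₂; [_,_])
import Data.Sum as Sum
import Data.Sum.Properties as Sum
import Data.Fin.Properties as Fin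
import Data.List.Membership.DecPropositional as DecMembership
open import Data.Vec using (Vec; []; _∷_; lookup; tabulate; replicate)
open import Data.Vec.Properties
  using (lookup∘tabulate; []=⇒lookup; lookup⇒[]=; lookup-replicate)
open import Data.Vec.Relation.Binary.Pointwise.Extensional using (ext; Pointwise-≡⇒≡)
open import Function.Bundles using (_⇔_; mk⇔; Equivalence)
open import Function.Construct.Composition using (_⇔-∘_)
open import Function.Construct.Symmetry using (⇔-sym)
open import Relation.Binary.PropositionalEquality
  using (_≡_; _≢_; refl; sym; trans; cong; cong₂; subst)
open import Relation.Nullary using (¬_; Dec; yes; no; does)
open import Relation.Nullary.Decidable using (_×-dec_; _⊎-dec_; _→-dec_; ¬?; map′; isYes; toWitness; fromWitness)
open import Relation.Unary using (Decidable)

open Equivalence using (to; from)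

-- Finite sums

Count : {A : Set} → (A → Set) → List A → ℕ → Set
Count P = SumOver P (λ _ → 1)

module _ {A : Set} {P : A → Set} {f : A → ℕ} where

  SumOver-unique : ∀ {xs r r′} → SumOver P f xs r → SumOver P f xs r′ → r ≡ r′
  SumOver-unique []          []          = refl
  SumOver-unique (take _ s)  (take _ s′) = cong (f _ +_) (SumOver-unique s s′)
  SumOver-unique (take p _)  (skip ¬p _) = ⊥-elim (¬p p)
  SumOver-unique (skip ¬p _) (take p _)  = ⊥-elim (¬p p)
  SumOver-unique (skip _ s)  (skip _ s′) = SumOver-unique s s′

  SumOver-total : Decidable P → ∀ xs → ∃ (SumOver P f xs)
  SumOver-total P? []       = 0 , []
  SumOver-total P? (a ∷ xs) with SumOver-total P? xs | P? a
  ... | r , s | yes p = f a + r , take p s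
  ... | r , s | no ¬p = r , skip ¬p s

  SumOver-empty : ∀ xs → (∀ a → ¬ P a) → SumOver P f xs 0
  SumOver-empty []       ¬P = []
  SumOver-empty (a ∷ xs) ¬P = skip (¬P a) (SumOver-empty xs ¬P)

  SumOver-++ : ∀ {xs ys r r′} → SumOver P f xs r → SumOver P f ys r′ → SumOver P f (xs ++ ys) (r + r′)
  SumOver-++ []                 s′ = s′
  SumOver-++ (take {r = r} p s) s′ =
    subst (SumOver P f _) (sym (+-assoc (f _) r _)) (take p (SumOver-++ s s′))
  SumOver-++ (skip ¬p s)        s′ = skip ¬p (SumOver-++ s s′)

  SumOver-resp : ∀ {Q : A → Set} {xs r} → (∀ a → P a ⇔ Q a) → SumOver P f xs r → SumOver Q f xs r
  SumOver-resp P⇔Q []          = []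
  SumOver-resp P⇔Q (take p s)  = take (to (P⇔Q _) p) (SumOver-resp P⇔Q s)
  SumOver-resp P⇔Q (skip ¬p s) = skip (λ q → ¬p (from (P⇔Q _) q)) (SumOver-resp P⇔Q s)

  SumOver-mono-≤ : ∀ {Q : A → Set} {g : A → ℕ} {xs r r′} → SumOver P f xs r → SumOver Q g xs r′
                 → (∀ a → P a → Q a × f a ≤ g a) → r ≤ r′
  SumOver-mono-≤ []          []          h = z≤n
  SumOver-mono-≤ (take p s)  (take q s′) h = +-mono-≤ (proj₂ (h _ p)) (SumOver-mono-≤ s s′ h)
  SumOver-mono-≤ (take p s)  (skip ¬q _) h = ⊥-elim (¬q (proj₁ (h _ p)))
  SumOver-mono-≤ (skip _ s)  (take _ s′) h = ≤-trans (SumOver-mono-≤ s s′ h) (m≤n+m _ _)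
  SumOver-mono-≤ (skip _ s)  (skip _ s′) h = SumOver-mono-≤ s s′ h

  SumOver-cong : ∀ {Q : A → Set} {g : A → ℕ} {xs r r′} → SumOver P f xs r → SumOver Q g xs r′
               → (∀ a → P a → Q a × f a ≡ g a) → (∀ a → Q a → ¬ P a → g a ≡ 0) → r ≡ r′
  SumOver-cong []          []          h h₀ = refl
  SumOver-cong (take p s)  (take q s′) h h₀ = cong₂ _+_ (proj₂ (h _ p)) (SumOver-cong s s′ h h₀)
  SumOver-cong (take p s)  (skip ¬q _) h h₀ = ⊥-elim (¬q (proj₁ (h _ p)))
  SumOver-cong (skip ¬p s) (take q s′) h h₀ rewrite h₀ _ q ¬p = SumOver-cong s s′ h h₀
  SumOver-cong (skip _ s)  (skip _ s′) h h₀ = SumOver-cong s s′ h h₀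

SumOver-map : ∀ {A B : Set} {P : B → Set} {f : B → ℕ} (h : A → B) {xs r}
            → SumOver (λ a → P (h a)) (λ a → f (h a)) xs r → SumOver P f (map h xs) r
SumOver-map h []          = []
SumOver-map h (take p s)  = take p (SumOver-map h s)
SumOver-map h (skip ¬p s) = skip ¬p (SumOver-map h s)

Count-scale : ∀ {A : Set} {P : A → Set} {xs r} k → Count P xs r → SumOver P (λ _ → k) xs (r * k)
Count-scale k []          = []
Count-scale k (take p s)  = take p (Count-scale k s)
Count-scale k (skip ¬p s) = skip ¬p (Count-scale k s)

Count-nonzero : ∀ {A : Set} {P : A → Set} {xs r} → Count P xs r → r ≢ 0 → ∃ P
Count-nonzero []          r≢0 = ⊥-elim (r≢0 refl)
Count-nonzero (take p _)  _   = _ , p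
Count-nonzero (skip _ s)  r≢0 = Count-nonzero s r≢0

module _ {A B : Set} {R : A × B → Set} {f : A × B → ℕ} where

  SumOver-allPairs : ∀ {P : A → Set} {g : A → ℕ} bs
    → (∀ a → P a → SumOver (λ b → R (a , b)) (λ b → f (a , b)) bs (g a))
    → (∀ a b → R (a , b) → P a)
    → ∀ {as r} → SumOver P g as r → SumOver R f (allPairs as bs) r
  SumOver-allPairs bs inner R⇒P []          = []
  SumOver-allPairs bs inner R⇒P (take p s)  =
    SumOver-++ (SumOver-map _ (inner _ p)) (SumOver-allPairs bs inner R⇒P s)
  SumOver-allPairs bs inner R⇒P (skip ¬p s) =
    SumOver-++ (SumOver-map _ (SumOver-empty bs λ b r → ¬p (R⇒P _ b r)))
               (SumOver-allPairs bs inner R⇒P s)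

Count-allPairs : ∀ {A B : Set} {P : A → Set} {Q : B → Set} {as bs r r′}
  → Count P as r → Count Q bs r′ → Count (λ ab → P (proj₁ ab) × Q (proj₂ ab)) (allPairs as bs) (r * r′)
Count-allPairs {r′ = r′} cP cQ =
  SumOver-allPairs _ (λ a p → SumOver-resp (λ b → mk⇔ (p ,_) proj₂) cQ) (λ _ _ → proj₁) (Count-scale r′ cP)

module _ {B : Set} where

  ∈-─ : ∀ {b c : B} {ys} (p : b ∈ₗ ys) → c ∈ₗ ys → c ≢ b → c ∈ₗ ys ─ p
  ∈-─ (here refl) (here refl) c≢b = ⊥-elim (c≢b refl)
  ∈-─ (here refl) (there q)   c≢b = q
  ∈-─ (there p)   (here e)    c≢b = here e
  ∈-─ (there p)   (there q)   c≢b = there (∈-─ p q c≢b)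

  Count-─ : ∀ {Q : B → Set} {b ys r} (p : b ∈ₗ ys) → Q b → Count Q ys r
          → ∃[ r′ ] (r ≡ suc r′ × Count Q (ys ─ p) r′)
  Count-─ (here refl) q (take _ s)  = _ , refl , s
  Count-─ (here refl) q (skip ¬q s) = ⊥-elim (¬q q)
  Count-─ (there p)   q (take q′ s) with Count-─ p q s
  ... | r′ , refl , s′ = suc r′ , refl , take q′ s′
  Count-─ (there p)   q (skip ¬q s) with Count-─ p q s
  ... | r′ , refl , s′ = r′ , refl , skip ¬q s′

module _ {A B : Set} {P : A → Set} {Q : B → Set} (f : A → B) (P⇒Q : ∀ a → P a → Q (f a))
         (f-injective : ∀ a a′ → P a → P a′ → f a ≡ f a′ → a ≡ a′) where

  Count-injection-≤ : ∀ {xs ys r r′} → Unique xs → Count P xs r → Count Q ys r′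
                    → (∀ a → a ∈ₗ xs → P a → f a ∈ₗ ys) → r ≤ r′
  Count-injection-≤ []          []          _ _ = z≤n
  Count-injection-≤ (a∉ ∷ uxs) (take pa s) s′ f∈ with Count-─ (f∈ _ (here refl) pa) (P⇒Q _ pa) s′
  ... | _ , refl , s″ = s≤s (Count-injection-≤ uxs s s″ λ a′ a′∈ pa′ →
        ∈-─ (f∈ _ (here refl) pa) (f∈ a′ (there a′∈) pa′)
          λ e → All.lookup a∉ a′∈ (sym (f-injective a′ _ pa′ pa e)))
  Count-injection-≤ (_ ∷ uxs)  (skip _ s)  s′ f∈ = Count-injection-≤ uxs s s′ λ a a∈ → f∈ a (there a∈)

Count-bijection : ∀ {A B : Set} {P : A → Set} {Q : B → Set} (f : A → B) (g : B → A)
  → (∀ a → P a → Q (f a)) → (∀ b → Q b → P (g b))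
  → (∀ a → P a → g (f a) ≡ a) → (∀ b → Q b → f (g b) ≡ b)
  → ∀ {xs ys r r′} → Unique xs → Unique ys → (∀ a → a ∈ₗ xs) → (∀ b → b ∈ₗ ys)
  → Count P xs r → Count Q ys r′ → r ≡ r′
Count-bijection f g P⇒Q Q⇒P gf fg uxs uys xs-complete ys-complete cP cQ = ≤-antisym
  (Count-injection-≤ f P⇒Q (λ a a′ pa pa′ e → trans (sym (gf a pa)) (trans (cong g e) (gf a′ pa′)))
     uxs cP cQ (λ a _ _ → ys-complete (f a)))
  (Count-injection-≤ g Q⇒P (λ b b′ qb qb′ e → trans (sym (fg b qb)) (trans (cong f e) (fg b′ qb′)))
     uys cQ cP (λ b _ _ → xs-complete (g b)))

-- Enumerations

concatMap≡cartesianProductWith : ∀ {A B C : Set} (f : A → B → C) (bs : List B) (as : List A)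
  → concatMap (λ a → map (f a) bs) as ≡ cartesianProductWith f as bs
concatMap≡cartesianProductWith f bs []       = refl
concatMap≡cartesianProductWith f bs (a ∷ as) = cong (map (f a) bs ++_) (concatMap≡cartesianProductWith f bs as)

module _ {A B : Set} {as : List A} {bs : List B} where

  ∈-allPairs : ∀ {a b} → a ∈ₗ as → b ∈ₗ bs → (a , b) ∈ₗ allPairs as bs
  ∈-allPairs a∈ b∈ = subst ((_ , _) ∈ₗ_) (sym (concatMap≡cartesianProductWith _,_ bs as))
    (∈-cartesianProductWith⁺ _,_ a∈ b∈)

  Unique-allPairs : Unique as → Unique bs → Unique (allPairs as bs)
  Unique-allPairs uas ubs = subst Unique (sym (concatMap≡cartesianProductWith _,_ bs as))
    (cartesianProductWith⁺ _,_ (λ { refl → refl , refl }) uas ubs)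

module _ {A : Set} {xs : List A} where

  ∈-allVec : (∀ a → a ∈ₗ xs) → ∀ n (v : Vec A n) → v ∈ₗ allVec xs n
  ∈-allVec xs-complete zero    []      = here refl
  ∈-allVec xs-complete (suc n) (a ∷ v) =
    subst ((a ∷ v) ∈ₗ_) (sym (concatMap≡cartesianProductWith _∷_ (allVec xs n) xs))
      (∈-cartesianProductWith⁺ _∷_ (xs-complete a) (∈-allVec xs-complete n v))

  Unique-allVec : Unique xs → ∀ n → Unique (allVec xs n)
  Unique-allVec uxs zero    = [] ∷ []
  Unique-allVec uxs (suc n) = subst Unique (sym (concatMap≡cartesianProductWith _∷_ (allVec xs n) xs))
    (cartesianProductWith⁺ _∷_ (λ { refl → refl , refl }) uxs (Unique-allVec uxs n))

∈-allMaybeBool : ∀ a → a ∈ₗ allMaybeBool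
∈-allMaybeBool nothing      = here refl
∈-allMaybeBool (just false) = there (here refl)
∈-allMaybeBool (just true)  = there (there (here refl))

Unique-allMaybeBool : Unique allMaybeBool
Unique-allMaybeBool = ((λ ()) ∷ (λ ()) ∷ []) ∷ ((λ ()) ∷ []) ∷ [] ∷ []

∈-allBool : ∀ b → b ∈ₗ (false ∷ true ∷ [])
∈-allBool false = here refl
∈-allBool true  = there (here refl)

Unique-allBool : Unique (false ∷ true ∷ [])
Unique-allBool = ((λ ()) ∷ []) ∷ [] ∷ []

∈-allPAssign : ∀ n (σ : PAssign n) → σ ∈ₗ allPAssign n
∈-allPAssign = ∈-allVec ∈-allMaybeBool

Unique-allPAssign : ∀ n → Unique (allPAssign n)
Unique-allPAssign = Unique-allVec Unique-allMaybeBool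

∈-allSubsets : ∀ m (S : Subset m) → S ∈ₗ allSubsets m
∈-allSubsets = ∈-allVec ∈-allBool

Unique-allSubsets : ∀ m → Unique (allSubsets m)
Unique-allSubsets = Unique-allVec Unique-allBool

Unique-++⁻ : ∀ {A : Set} (xs : List A) {ys} → Unique (xs ++ ys)
           → Unique xs × Unique ys × (∀ {a} → a ∈ₗ xs → a ∈ₗ ys → ⊥)
Unique-++⁻ []       u         = [] , u , λ ()
Unique-++⁻ (x ∷ xs) (x∉ ∷ u) with Unique-++⁻ xs u
... | uxs , uys , disjoint = (++⁻ˡ xs x∉ ∷ uxs) , uys , λ
  { (here refl) a∈ys → All.lookup (++⁻ʳ xs x∉) a∈ys refl
  ; (there a∈xs) a∈ys → disjoint a∈xs a∈ys }

-- Subsets and partial assignments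

module _ {k : ℕ} where

  ⁅_⁆ : {P : Fin k → Set} → Decidable P → Subset k
  ⁅ P? ⁆ = tabulate (λ c → isYes (P? c))

  ∈⁅⁆ : {P : Fin k → Set} (P? : Decidable P) → ∀ c → c ∈ˢ ⁅ P? ⁆ ⇔ P c
  ∈⁅⁆ P? c = mk⇔
    (λ c∈ → toWitness {a? = P? c} (from T-≡ (trans (sym (lookup∘tabulate _ c)) ([]=⇒lookup c∈))))
    (λ p → lookup⇒[]= c _ (trans (lookup∘tabulate _ c) (to T-≡ (fromWitness p))))

  ⁅⁆-unique : {P : Fin k → Set} (P? : Decidable P) {S : Subset k} → (∀ c → c ∈ˢ S ⇔ P c) → ⁅ P? ⁆ ≡ S
  ⁅⁆-unique P? S⇔P = ⊆-antisym (λ {c} c∈ → from (S⇔P c) (to (∈⁅⁆ P? c) c∈))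
                               (λ {c} c∈ → from (∈⁅⁆ P? c) (to (S⇔P c) c∈))

just≢nothing : ∀ {b : Bool} → just b ≢ nothing
just≢nothing ()

module _ {n : ℕ} {X : Fin n → Set} (X? : Decidable X) where

  merge : PAssign n → PAssign n → PAssign n
  merge σ τ = tabulate λ v → if does (X? v) then lookup σ v else lookup τ v

  restrict : PAssign n → PAssign n
  restrict σ = merge σ (replicate n nothing)

  lookup-merge : ∀ σ τ v → lookup (merge σ τ) v ≡ (if does (X? v) then lookup σ v else lookup τ v)
  lookup-merge σ τ v = lookup∘tabulate _ v

  lookup-merge-∈ : ∀ σ τ v → X v → lookup (merge σ τ) v ≡ lookup σ v
  lookup-merge-∈ σ τ v x with X? v | lookup-merge σ τ v
  ... | yes _ | e = e
  ... | no ¬x | _ = ⊥-elim (¬x x)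

  lookup-merge-∉ : ∀ σ τ v → ¬ X v → lookup (merge σ τ) v ≡ lookup τ v
  lookup-merge-∉ σ τ v ¬x with X? v | lookup-merge σ τ v
  ... | yes x | _ = ⊥-elim (¬x x)
  ... | no _  | e = e

  lookup-restrict-∉ : ∀ σ v → ¬ X v → lookup (restrict σ) v ≡ nothing
  lookup-restrict-∉ σ v ¬x = trans (lookup-merge-∉ σ (replicate n nothing) v ¬x) (lookup-replicate v nothing)

  Sat-merge⁻ : ∀ σ τ C → Sat (merge σ τ) C → Sat σ C ⊎ Sat τ C
  Sat-merge⁻ σ τ C (v , b , C∋ , σ′v) with X? v | lookup-merge σ τ v
  ... | yes _ | e = inj₁ (v , b , C∋ , trans (sym e) σ′v)
  ... | no _  | e = inj₂ (v , b , C∋ , trans (sym e) σ′v)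

  Sat-merge⁺ : ∀ σ τ C → (∀ v → ¬ X v → lookup σ v ≡ nothing) → (∀ v → X v → lookup τ v ≡ nothing)
             → Sat σ C ⊎ Sat τ C → Sat (merge σ τ) C
  Sat-merge⁺ σ τ C σ⊆X τ⊆∁X (inj₁ (v , b , C∋ , σv)) with X? v | lookup-merge σ τ v
  ... | yes _ | e = v , b , C∋ , trans e σv
  ... | no ¬x | _ = ⊥-elim (just≢nothing (trans (sym σv) (σ⊆X v ¬x)))
  Sat-merge⁺ σ τ C σ⊆X τ⊆∁X (inj₂ (v , b , C∋ , τv)) with X? v | lookup-merge σ τ v
  ... | yes x | _ = ⊥-elim (just≢nothing (trans (sym τv) (τ⊆∁X v x)))
  ... | no _  | e = v , b , C∋ , trans e τv

  Sat-merge : ∀ σ τ C → (∀ v → ¬ X v → lookup σ v ≡ nothing) → (∀ v → X v → lookup τ v ≡ nothing)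
            → Sat (merge σ τ) C ⇔ (Sat σ C ⊎ Sat τ C)
  Sat-merge σ τ C σ⊆X τ⊆∁X = mk⇔ (Sat-merge⁻ σ τ C) (Sat-merge⁺ σ τ C σ⊆X τ⊆∁X)

  Sat-restrict⁻ : ∀ σ C → Sat (restrict σ) C → Sat σ C
  Sat-restrict⁻ σ C s with Sat-merge⁻ σ (replicate n nothing) C s
  ... | inj₁ sσ = sσ
  ... | inj₂ (v , b , _ , e) = ⊥-elim (just≢nothing (trans (sym e) (lookup-replicate v nothing)))

  Sat-restrict⁺ : ∀ σ C v b → lookup C v ≡ just b → lookup σ v ≡ just b → X v → Sat (restrict σ) C
  Sat-restrict⁺ σ C v b C∋ σv x = v , b , C∋ , trans (lookup-merge-∈ σ (replicate n nothing) v x) σv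

  IsAssignOn-restrict : ∀ {Z : Fin n → Set} → (∀ v → X v → Z v)
                      → ∀ σ → IsAssignOn Z σ → IsAssignOn X (restrict σ)
  IsAssignOn-restrict X⊆Z σ σ-on v =
    (λ x → subst (λ w → ∃[ b ] (w ≡ just b)) (sym (lookup-merge-∈ σ (replicate n nothing) v x))
                 (proj₁ (σ-on v) (X⊆Z v x)))
    , lookup-restrict-∉ σ v

module _ {n : ℕ} where

  IsAssignOn-dom : ∀ {X : Fin n → Set} (X? : Decidable X) {σ} → IsAssignOn X σ
                 → ∀ v b → lookup σ v ≡ just b → X v
  IsAssignOn-dom X? σ-on v b σv with X? v
  ... | yes x = x
  ... | no ¬x = ⊥-elim (just≢nothing (trans (sym σv) (proj₂ (σ-on v) ¬x)))

  module _ {X Y : Fin n → Set} (X? : Decidable X) (Y? : Decidable Y) where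

    restrict-merge-ˡ : ∀ {σ} τ → IsAssignOn X σ → restrict X? (merge X? σ τ) ≡ σ
    restrict-merge-ˡ {σ} τ σ-on = Pointwise-≡⇒≡ (ext pointwise)
      where
      pointwise : ∀ v → lookup (restrict X? (merge X? σ τ)) v ≡ lookup σ v
      pointwise v with X? v
      ... | yes x = trans (lookup-merge-∈ X? (merge X? σ τ) (replicate n nothing) v x) (lookup-merge-∈ X? σ τ v x)
      ... | no ¬x = trans (lookup-restrict-∉ X? (merge X? σ τ) v ¬x) (sym (proj₂ (σ-on v) ¬x))

    restrict-merge-ʳ : ∀ σ {τ} → IsAssignOn Y τ → (∀ v → X v → ¬ Y v) → restrict Y? (merge X? σ τ) ≡ τ
    restrict-merge-ʳ σ {τ} τ-on X∩Y=∅ = Pointwise-≡⇒≡ (ext pointwise)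
      where
      pointwise : ∀ v → lookup (restrict Y? (merge X? σ τ)) v ≡ lookup τ v
      pointwise v with Y? v
      ... | yes y = trans (lookup-merge-∈ Y? (merge X? σ τ) (replicate n nothing) v y)
                          (lookup-merge-∉ X? σ τ v λ x → X∩Y=∅ v x y)
      ... | no ¬y = trans (lookup-restrict-∉ Y? (merge X? σ τ) v ¬y) (sym (proj₂ (τ-on v) ¬y))

    module _ {Z : Fin n → Set} (Z⊆X∪Y : ∀ v → Z v → X v ⊎ Y v) where

      merge-restrict : ∀ {σ} → IsAssignOn Z σ → merge X? (restrict X? σ) (restrict Y? σ) ≡ σ
      merge-restrict {σ} σ-on = Pointwise-≡⇒≡ (ext pointwise)
        where
        pointwise : ∀ v → lookup (merge X? (restrict X? σ) (restrict Y? σ)) v ≡ lookup σ v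
        pointwise v with X? v | Y? v
        ... | yes x | _     = trans (lookup-merge-∈ X? (restrict X? σ) (restrict Y? σ) v x)
                                    (lookup-merge-∈ X? σ (replicate n nothing) v x)
        ... | no ¬x | yes y = trans (lookup-merge-∉ X? (restrict X? σ) (restrict Y? σ) v ¬x)
                                    (lookup-merge-∈ Y? σ (replicate n nothing) v y)
        ... | no ¬x | no ¬y = trans (lookup-merge-∉ X? (restrict X? σ) (restrict Y? σ) v ¬x)
                              (trans (lookup-restrict-∉ Y? σ v ¬y)
                                     (sym (proj₂ (σ-on v) λ z → [ ¬x , ¬y ] (Z⊆X∪Y v z))))

      Sat-restrict-split : ∀ {σ} (Z? : Decidable Z) → IsAssignOn Z σ → ∀ C
                         → Sat σ C ⇔ (Sat (restrict X? σ) C ⊎ Sat (restrict Y? σ) C)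
      Sat-restrict-split {σ} Z? σ-on C = mk⇔ split [ Sat-restrict⁻ X? σ C , Sat-restrict⁻ Y? σ C ]
        where
        split : Sat σ C → Sat (restrict X? σ) C ⊎ Sat (restrict Y? σ) C
        split (v , b , C∋ , σv) with Z⊆X∪Y v (IsAssignOn-dom Z? {σ} σ-on v b σv)
        ... | inj₁ x = inj₁ (Sat-restrict⁺ X? σ C v b C∋ σv x)
        ... | inj₂ y = inj₂ (Sat-restrict⁺ Y? σ C v b C∋ σv y)

      IsAssignOn-merge : (∀ v → X v → Z v) → (∀ v → Y v → Z v) → ∀ {σ τ}
                       → IsAssignOn X σ → IsAssignOn Y τ → IsAssignOn Z (merge X? σ τ)
      IsAssignOn-merge X⊆Z Y⊆Z {σ} {τ} σ-on τ-on v = assigned , unassigned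
        where
        assigned : Z v → ∃[ b ] (lookup (merge X? σ τ) v ≡ just b)
        assigned z with X? v | lookup-merge X? σ τ v
        ... | yes x | e = subst (λ w → ∃[ b ] (w ≡ just b)) (sym e) (proj₁ (σ-on v) x)
        ... | no ¬x | e = subst (λ w → ∃[ b ] (w ≡ just b)) (sym e)
                            (proj₁ (τ-on v) ([ (λ x → ⊥-elim (¬x x)) , (λ y → y) ] (Z⊆X∪Y v z)))
        unassigned : ¬ Z v → lookup (merge X? σ τ) v ≡ nothing
        unassigned ¬z = trans (lookup-merge-∉ X? σ τ v (λ x → ¬z (X⊆Z v x)))
                              (proj₂ (τ-on v) (λ y → ¬z (Y⊆Z v y)))

-- Decidability

_⇔-dec_ : ∀ {A B : Set} → Dec A → Dec B → Dec (A ⇔ B)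
a? ⇔-dec b? = map′ (uncurry mk⇔) (λ e → to e , from e) ((a? →-dec b?) ×-dec (b? →-dec a?))

defined? : (b : Maybe Bool) → Dec (∃[ b′ ] (b ≡ just b′))
defined? nothing  = no λ ()
defined? (just b) = yes (b , refl)

module _ {n : ℕ} where

  _∈var?_ : ∀ v (C : Clause n) → Dec (v ∈var C)
  v ∈var? C = defined? (lookup C v)

  Sat? : ∀ (σ : PAssign n) C → Dec (Sat σ C)
  Sat? σ C = any? λ v → agree? (lookup C v) (lookup σ v)
    where
    agree? : (c s : Maybe Bool) → Dec (∃[ b ] (c ≡ just b × s ≡ just b))
    agree? nothing  s = no λ ()
    agree? (just b) s = map′ (λ e → b , refl , e) (λ { (_ , refl , e) → e }) (Maybe.≡-dec Bool._≟_ s (just b))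

  IsAssignOn? : {X : Fin n → Set} → Decidable X → Decidable (IsAssignOn X)
  IsAssignOn? X? σ = all? λ v → (X? v →-dec defined? (lookup σ v))
                              ×-dec (¬? (X? v) →-dec Maybe.≡-dec Bool._≟_ (lookup σ v) nothing)

module _ (F : CNF) where
  open CNF F

  open DecMembership {A = Vertex F} (Sum.≡-dec Fin._≟_ Fin._≟_) using () renaming (_∈?_ to _∈leaves?_)

  InVar? : ∀ t → Decidable (InVar F t)
  InVar? t v = inj₁ v ∈leaves? leaves t

  InF? : ∀ t → Decidable (InF F t)
  InF? t c = inj₂ c ∈leaves? leaves t

  InFC? : ∀ t → Decidable (InFC F t)
  InFC? t c = ¬? (InF? t c)

  VarF? : Decidable (VarF F)
  VarF? v = any? λ c → v ∈var? clause c

  InVarC? : ∀ t → Decidable (InVarC F t)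
  InVarC? t v = VarF? v ×-dec ¬? (InVar? t v)

  SatSetIs? : ∀ {G : Fin m → Set} → Decidable G → ∀ σ S → Dec (SatSetIs F G σ S)
  SatSetIs? G? σ S = all? λ c → (c ∈ˢ? S) ⇔-dec (G? c ×-dec Sat? σ (clause c))

  OfShape? : ∀ t s → Decidable (OfShape F t s)
  OfShape? t (out , inn) τ = IsAssignOn? (InVar? t) τ ×-dec SatSetIs? (InFC? t) τ out
    ×-dec all? (λ c → InF? t c →-dec (Sat? τ (clause c) ⊎-dec (c ∈ˢ? inn)))

  IsShape? : ∀ t → Decidable (IsShape F t)
  IsShape? t (out , inn) =
    all? (λ c → (c ∈ˢ? out) →-dec InFC? t c) ×-dec all? (λ c → (c ∈ˢ? inn) →-dec InF? t c)

  Gen? : ∀ z x y s → Decidable (Gen F z x y s)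
  Gen? z x y (outz , inz) ((outx , inx) , (outy , iny)) =
    IsShape? x (outx , inx) ×-dec IsShape? y (outy , iny)
    ×-dec all? (λ c → (c ∈ˢ? outz) ⇔-dec (((c ∈ˢ? outx) ⊎-dec (c ∈ˢ? outy)) ×-dec InFC? z c))
    ×-dec all? (λ c → (c ∈ˢ? inx) ⇔-dec (((c ∈ˢ? inz) ⊎-dec (c ∈ˢ? outy)) ×-dec InF? x c))
    ×-dec all? (λ c → (c ∈ˢ? iny) ⇔-dec (((c ∈ˢ? inz) ⊎-dec (c ∈ˢ? outx)) ×-dec InF? y c))

  Sup? : ∀ {G : Fin m → Set} → Decidable G → ∀ X → Decidable (Sup F G X)
  Sup? G? X c = G? c ×-dec all? (λ v → (v ∈ˢ? X) →-dec (v ∈var? clause c))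

  count : Tree F → Shape F → ℕ
  count t s = proj₁ (SumOver-total {f = λ _ → 1} (OfShape? t s) (allPAssign n))

  count-NCount : ∀ t s → NCount F t s (count t s)
  count-NCount t s = proj₂ (SumOver-total {f = λ _ → 1} (OfShape? t s) (allPAssign n))

  record Split (z x y : Tree F) : Set where
    field
      var-split       : ∀ v → InVar F z v → InVar F x v ⊎ InVar F y v
      varˡ            : ∀ v → InVar F x v → InVar F z v
      varʳ            : ∀ v → InVar F y v → InVar F z v
      var-disjoint    : ∀ v → InVar F x v → ¬ InVar F y v
      var-occurs      : ∀ v → InVar F z v → VarF F v
      clause-split    : ∀ c → InF F z c → InF F x c ⊎ InF F y c
      clauseˡ         : ∀ c → InF F x c → InF F z c
      clauseʳ         : ∀ c → InF F y c → InF F z c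
      clause-disjoint : ∀ c → InF F x c → ¬ InF F y c

  Split-swap : ∀ {z x y} → Split z x y → Split z y x
  Split-swap sp = record
    { var-split       = λ v p → Sum.swap (var-split v p)
    ; varˡ            = varʳ
    ; varʳ            = varˡ
    ; var-disjoint    = λ v p q → var-disjoint v q p
    ; var-occurs      = var-occurs
    ; clause-split    = λ c p → Sum.swap (clause-split c p)
    ; clauseˡ         = clauseʳ
    ; clauseʳ         = clauseˡ
    ; clause-disjoint = λ c p q → clause-disjoint c q p
    }
    where open Split sp

  ⊑-leaves : ∀ {t T : Tree F} → t ⊑ T
           → (∀ {w} → w ∈ₗ leaves t → w ∈ₗ leaves T) × (Unique (leaves T) → Unique (leaves t))
  ⊑-leaves here = (λ w∈ → w∈) , (λ u → u)
  ⊑-leaves {T = node l r} (left t⊑l) =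
    (λ w∈ → ∈-++⁺ˡ (proj₁ (⊑-leaves t⊑l) w∈)) ,
    λ u → proj₂ (⊑-leaves t⊑l) (proj₁ (Unique-++⁻ (leaves l) u))
  ⊑-leaves {T = node l r} (right t⊑r) =
    (λ w∈ → ∈-++⁺ʳ (leaves l) (proj₁ (⊑-leaves t⊑r) w∈)) ,
    λ u → proj₂ (⊑-leaves t⊑r) (proj₁ (proj₂ (Unique-++⁻ (leaves l) u)))

  node-Split : ∀ {T x y} → IsDecompTree F T → node x y ⊑ T → Split (node x y) x y
  node-Split {T} {x} {y} (unique-leaves , vertices) x∙y⊑T = record
    { var-split       = λ v → ∈-++⁻ (leaves x)
    ; varˡ            = λ v → ∈-++⁺ˡ
    ; varʳ            = λ v → ∈-++⁺ʳ (leaves x)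
    ; var-disjoint    = λ v → disjoint
    ; var-occurs      = λ v v∈ → to (vertices (inj₁ v)) (⊆T v∈)
    ; clause-split    = λ c → ∈-++⁻ (leaves x)
    ; clauseˡ         = λ c → ∈-++⁺ˡ
    ; clauseʳ         = λ c → ∈-++⁺ʳ (leaves x)
    ; clause-disjoint = λ c → disjoint
    }
    where
    ⊆T : ∀ {w} → w ∈ₗ leaves (node x y) → w ∈ₗ leaves T
    ⊆T = proj₁ (⊑-leaves x∙y⊑T)
    disjoint : ∀ {w} → w ∈ₗ leaves x → w ∈ₗ leaves y → ⊥
    disjoint = proj₂ (proj₂ (Unique-++⁻ (leaves x) (proj₂ (⊑-leaves x∙y⊑T) unique-leaves)))

  restrictTo : Tree F → PAssign n → PAssign n
  restrictTo t = restrict (InVar? t)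

  outOf? : ∀ t τ → Decidable (λ c → InFC F t c × Sat (restrictTo t τ) (clause c))
  outOf? t τ c = InFC? t c ×-dec Sat? (restrictTo t τ) (clause c)

  outOf : Tree F → PAssign n → Subset m
  outOf t τ = ⁅ outOf? t τ ⁆

  inOf? : ∀ t t′ inz τ → Decidable (λ c → (c ∈ˢ inz ⊎ c ∈ˢ outOf t′ τ) × InF F t c)
  inOf? t t′ inz τ c = ((c ∈ˢ? inz) ⊎-dec (c ∈ˢ? outOf t′ τ)) ×-dec InF? t c

  inOf : Tree F → Tree F → Subset m → PAssign n → Subset m
  inOf t t′ inz τ = ⁅ inOf? t t′ inz τ ⁆

  -- the shape at the child t of z induced by an assignment τ of var_z; t′ is the sibling of t
  childShape : Tree F → Tree F → Subset m → PAssign n → Shape F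
  childShape t t′ inz τ = outOf t τ , inOf t t′ inz τ

  childShape-IsShape : ∀ t t′ inz τ → IsShape F t (childShape t t′ inz τ)
  childShape-IsShape t t′ inz τ =
    (λ c c∈ → proj₁ (to (∈⁅⁆ (outOf? t τ) c) c∈)) ,
    (λ c c∈ → proj₂ (to (∈⁅⁆ (inOf? t t′ inz τ) c) c∈))

  outOf-unique : ∀ {t τ a out} → restrictTo t τ ≡ a → SatSetIs F (InFC F t) a out → outOf t τ ≡ out
  outOf-unique {t} {τ} refl sat = ⁅⁆-unique (outOf? t τ) sat

  inOf-unique : ∀ {t t′ inz τ out′ inn} → outOf t′ τ ≡ out′
              → (∀ c → c ∈ˢ inn ⇔ ((c ∈ˢ inz ⊎ c ∈ˢ out′) × InF F t c)) → inOf t t′ inz τ ≡ inn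
  inOf-unique {t} {t′} {inz} {τ} refl inn⇔ = ⁅⁆-unique (inOf? t t′ inz τ) inn⇔

  in-covered : ∀ {x y inz outx inx outy a b}
             → (∀ c → c ∈ˢ inx ⇔ ((c ∈ˢ inz ⊎ c ∈ˢ outy) × InF F x c))
             → OfShape F x (outx , inx) a → SatSetIs F (InFC F y) b outy
             → ∀ c → InF F x c → (Sat a (clause c) ⊎ Sat b (clause c)) ⊎ c ∈ˢ inz
  in-covered inx⇔ (_ , _ , covered) sat-outy c c∈x with covered c c∈x
  ... | inj₁ sat-a = inj₁ (inj₁ sat-a)
  ... | inj₂ c∈inx with to (inx⇔ c) c∈inx
  ... | inj₁ c∈inz  , _ = inj₂ c∈inz
  ... | inj₂ c∈outy , _ = inj₁ (inj₂ (proj₂ (to (sat-outy c) c∈outy)))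

  Generated : Tree F → Tree F → Tree F → Shape F → (Shape F × Shape F) × (PAssign n × PAssign n) → Set
  Generated z x y s ((sx , sy) , (a , b)) = Gen F z x y s (sx , sy) × OfShape F x sx a × OfShape F y sy b

  module _ {z x y : Tree F} (sp : Split z x y) where
    open Split sp

    Sat-restrictTo : ∀ {τ} → IsAssignOn (InVar F z) τ → ∀ C
                   → Sat τ C ⇔ (Sat (restrictTo x τ) C ⊎ Sat (restrictTo y τ) C)
    Sat-restrictTo {τ} = Sat-restrict-split (InVar? x) (InVar? y) var-split {τ} (InVar? z)

    Sat-mergeChildren : ∀ a b → IsAssignOn (InVar F x) a → IsAssignOn (InVar F y) b → ∀ C
                      → Sat (merge (InVar? x) a b) C ⇔ (Sat a C ⊎ Sat b C)
    Sat-mergeChildren a b a-on b-on C =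
      Sat-merge (InVar? x) a b C (λ v → proj₂ (a-on v)) (λ v v∈x → proj₂ (b-on v) (var-disjoint v v∈x))

    out-Gen : ∀ {outx outy} σ a b → (∀ C → Sat σ C ⇔ (Sat a C ⊎ Sat b C))
            → SatSetIs F (InFC F x) a outx → SatSetIs F (InFC F y) b outy
            → ∀ c → (InFC F z c × Sat σ (clause c)) ⇔ ((c ∈ˢ outx ⊎ c ∈ˢ outy) × InFC F z c)
    out-Gen {outx} {outy} σ a b Sat-σ sat-outx sat-outy c = mk⇔ into back
      where
      into : InFC F z c × Sat σ (clause c) → (c ∈ˢ outx ⊎ c ∈ˢ outy) × InFC F z c
      into (c∉z , sat) with to (Sat-σ (clause c)) sat
      ... | inj₁ sat-a = inj₁ (from (sat-outx c) ((λ c∈x → c∉z (clauseˡ c c∈x)) , sat-a)) , c∉z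
      ... | inj₂ sat-b = inj₂ (from (sat-outy c) ((λ c∈y → c∉z (clauseʳ c c∈y)) , sat-b)) , c∉z
      back : (c ∈ˢ outx ⊎ c ∈ˢ outy) × InFC F z c → InFC F z c × Sat σ (clause c)
      back (inj₁ c∈outx , c∉z) = c∉z , from (Sat-σ (clause c)) (inj₁ (proj₂ (to (sat-outx c) c∈outx)))
      back (inj₂ c∈outy , c∉z) = c∉z , from (Sat-σ (clause c)) (inj₂ (proj₂ (to (sat-outy c) c∈outy)))

    split-Gen : ∀ {oz iz} τ → OfShape F z (oz , iz) τ
              → Gen F z x y (oz , iz) (childShape x y iz τ , childShape y x iz τ)
    split-Gen {oz} {iz} τ (τ-on , sat-oz , _) =
      childShape-IsShape x y iz τ , childShape-IsShape y x iz τ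
      , (λ c → out-Gen τ (restrictTo x τ) (restrictTo y τ) (Sat-restrictTo {τ} τ-on)
                      (∈⁅⁆ (outOf? x τ)) (∈⁅⁆ (outOf? y τ)) c
              ⇔-∘ sat-oz c)
      , ∈⁅⁆ (inOf? x y iz τ) , ∈⁅⁆ (inOf? y x iz τ)

    merge-OfShape : ∀ {oz iz ox ix oy iy} a b → Gen F z x y (oz , iz) ((ox , ix) , (oy , iy))
                  → OfShape F x (ox , ix) a → OfShape F y (oy , iy) b
                  → OfShape F z (oz , iz) (merge (InVar? x) a b)
    merge-OfShape {iz = iz} a b (_ , _ , oz⇔ , ix⇔ , iy⇔) ofx@(a-on , sat-ox , _) ofy@(b-on , sat-oy , _) =
      IsAssignOn-merge (InVar? x) (InVar? y) var-split varˡ varʳ {a} {b} a-on b-on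
      , (λ c → ⇔-sym (out-Gen (merge (InVar? x) a b) a b (Sat-mergeChildren a b a-on b-on) sat-ox sat-oy c)
              ⇔-∘ oz⇔ c)
      , covers
      where
      covers : ∀ c → InF F z c → Sat (merge (InVar? x) a b) (clause c) ⊎ c ∈ˢ iz
      covers c c∈z = Sum.map₁ (from (Sat-mergeChildren a b a-on b-on (clause c))) (inChild (clause-split c c∈z))
        where
        inChild : InF F x c ⊎ InF F y c → (Sat a (clause c) ⊎ Sat b (clause c)) ⊎ c ∈ˢ iz
        inChild (inj₁ c∈x) = in-covered {x = x} {y} {a = a} {b} ix⇔ ofx sat-oy c c∈x
        inChild (inj₂ c∈y) = Sum.map₁ Sum.swap (in-covered {x = y} {x} {a = b} {a} iy⇔ ofy sat-ox c c∈y)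

  restrict-OfShape : ∀ {z x y oz iz} → Split z x y → ∀ τ → OfShape F z (oz , iz) τ
                   → OfShape F x (childShape x y iz τ) (restrictTo x τ)
  restrict-OfShape {z} {x} {y} {iz = iz} sp τ (τ-on , _ , covered) =
    IsAssignOn-restrict (InVar? x) varˡ τ τ-on , ∈⁅⁆ (outOf? x τ) , covers
    where
    open Split sp
    covers : ∀ c → InF F x c → Sat (restrictTo x τ) (clause c) ⊎ c ∈ˢ inOf x y iz τ
    covers c c∈x with covered c (clauseˡ c c∈x)
    ... | inj₂ c∈iz = inj₂ (from (∈⁅⁆ (inOf? x y iz τ) c) (inj₁ c∈iz , c∈x))
    ... | inj₁ sat with to (Sat-restrictTo sp {τ} τ-on (clause c)) sat
    ... | inj₁ sat-x = inj₁ sat-x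
    ... | inj₂ sat-y = inj₂ (from (∈⁅⁆ (inOf? x y iz τ) c)
                              (inj₂ (from (∈⁅⁆ (outOf? y τ) c) (clause-disjoint c c∈x , sat-y)) , c∈x))

  allCandidates : List ((Shape F × Shape F) × (PAssign n × PAssign n))
  allCandidates = allPairs (allShapePairs F) (allPairs (allPAssign n) (allPAssign n))

  ∈-allCandidates : ∀ t → t ∈ₗ allCandidates
  ∈-allCandidates (((ox , ix) , (oy , iy)) , (a , b)) =
    ∈-allPairs (∈-allPairs (∈-allPairs (∈S ox) (∈S ix)) (∈-allPairs (∈S oy) (∈S iy)))
               (∈-allPairs (∈-allPAssign n a) (∈-allPAssign n b))
    where
    ∈S : ∀ (S : Subset m) → S ∈ₗ allSubsets m
    ∈S = ∈-allSubsets m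

  Unique-allCandidates : Unique allCandidates
  Unique-allCandidates = Unique-allPairs (Unique-allPairs uShapes uShapes) (Unique-allPairs uA uA)
    where
    uShapes : Unique (allShapes F)
    uShapes = Unique-allPairs (Unique-allSubsets m) (Unique-allSubsets m)
    uA : Unique (allPAssign n)
    uA = Unique-allPAssign n

  -- Assignments of shape s below z correspond to pairs of assignments below x and y whose shapes generate s.
  count-node : ∀ {z x y} → Split z x y → ∀ s
    → SumOver (Gen F z x y s) (λ p → count x (proj₁ p) * count y (proj₂ p)) (allShapePairs F) (count z s)
  count-node {z} {x} {y} sp s@(oz , iz) =
    subst (SumOver _ _ _) (sym (Count-bijection split join split-ok join-ok join-split split-join
            (Unique-allPAssign n) Unique-allCandidates (∈-allPAssign n) ∈-allCandidates
            (count-NCount z s) count-Generated))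
          (proj₂ sumGen)
    where
    open Split sp
    sumGen : ∃ (SumOver (Gen F z x y s) (λ p → count x (proj₁ p) * count y (proj₂ p)) (allShapePairs F))
    sumGen = SumOver-total {f = λ p → count x (proj₁ p) * count y (proj₂ p)} (Gen? z x y s) (allShapePairs F)

    count-Generated : Count (Generated z x y s) allCandidates (proj₁ sumGen)
    count-Generated = SumOver-allPairs _
      (λ p gen → SumOver-resp (λ _ → mk⇔ (gen ,_) proj₂)
                   (Count-allPairs (count-NCount x (proj₁ p)) (count-NCount y (proj₂ p))))
      (λ _ _ → proj₁) (proj₂ sumGen)

    split : PAssign n → (Shape F × Shape F) × (PAssign n × PAssign n)
    split τ = (childShape x y iz τ , childShape y x iz τ) , (restrictTo x τ , restrictTo y τ)

    join : (Shape F × Shape F) × (PAssign n × PAssign n) → PAssign n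
    join (_ , (a , b)) = merge (InVar? x) a b

    split-ok : ∀ τ → OfShape F z s τ → Generated z x y s (split τ)
    split-ok τ of = split-Gen sp τ of , restrict-OfShape sp τ of , restrict-OfShape (Split-swap sp) τ of

    join-ok : ∀ t → Generated z x y s t → OfShape F z s (join t)
    join-ok (_ , (a , b)) (gen , ofx , ofy) = merge-OfShape sp a b gen ofx ofy

    join-split : ∀ τ → OfShape F z s τ → join (split τ) ≡ τ
    join-split τ (τ-on , _) = merge-restrict (InVar? x) (InVar? y) var-split {τ} τ-on

    split-join : ∀ t → Generated z x y s t → split (join t) ≡ t
    split-join (((ox , ix) , (oy , iy)) , (a , b)) ((_ , _ , _ , ix⇔ , iy⇔) , (a-on , sat-ox , _) , (b-on , sat-oy , _)) =
      cong₂ _,_ (cong₂ _,_ (cong₂ _,_ ox≡ (inOf-unique {x} {y} {iz} {τ′} oy≡ ix⇔))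
                           (cong₂ _,_ oy≡ (inOf-unique {y} {x} {iz} {τ′} ox≡ iy⇔)))
                (cong₂ _,_ a≡ b≡)
      where
      τ′ : PAssign n
      τ′ = merge (InVar? x) a b
      a≡ : restrictTo x τ′ ≡ a
      a≡ = restrict-merge-ˡ (InVar? x) (InVar? y) b a-on
      b≡ : restrictTo y τ′ ≡ b
      b≡ = restrict-merge-ʳ (InVar? x) (InVar? y) a b-on var-disjoint
      ox≡ : outOf x τ′ ≡ ox
      ox≡ = outOf-unique {x} {τ′} a≡ sat-ox
      oy≡ : outOf y τ′ ≡ oy
      oy≡ = outOf-unique {y} {τ′} b≡ sat-oy

  -- The in-part of x is realised by the assignment realising in_z, extended by τy on var_y.
  Proper-child : ∀ {z x y oz iz ox ix oy iy} τx τy → Split z x y → Proper F z (oz , iz)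
    → (∀ c → c ∈ˢ ix ⇔ ((c ∈ˢ iz ⊎ c ∈ˢ oy) × InF F x c))
    → OfShape F x (ox , ix) τx → OfShape F y (oy , iy) τy → Proper F x (ox , ix)
  Proper-child {z} {x} {y} {iz = iz} {ix = ix} {oy = oy} τx τy sp (_ , σ , σ-on , sat-iz) ix⇔
               (τx-on , sat-ox , _) (τy-on , sat-oy , _) =
    (τx , τx-on , sat-ox) , (σ′ , σ′-on , λ c → mk⇔ into back ⇔-∘ ix⇔ c)
    where
    open Split sp
    σ′ : PAssign n
    σ′ = merge (InVar? y) τy σ

    σ′-on : IsAssignOn (InVarC F x) σ′
    σ′-on = IsAssignOn-merge (InVar? y) (InVarC? z) varC-split
      (λ v v∈y → var-occurs v (varʳ v v∈y) , λ v∈x → var-disjoint v v∈x v∈y)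
      (λ v (occ , v∉z) → occ , λ v∈x → v∉z (varˡ v v∈x)) {τy} {σ} τy-on σ-on
      where
      varC-split : ∀ v → InVarC F x v → InVar F y v ⊎ InVarC F z v
      varC-split v (occ , v∉x) with InVar? y v
      ... | yes v∈y = inj₁ v∈y
      ... | no v∉y  = inj₂ (occ , λ v∈z → [ v∉x , v∉y ] (var-split v v∈z))

    Sat-σ′ : ∀ C → Sat σ′ C ⇔ (Sat τy C ⊎ Sat σ C)
    Sat-σ′ C = Sat-merge (InVar? y) τy σ C (λ v → proj₂ (τy-on v))
                 (λ v v∈y → proj₂ (σ-on v) λ (_ , v∉z) → v∉z (varʳ v v∈y))

    into : ∀ {c} → (c ∈ˢ iz ⊎ c ∈ˢ oy) × InF F x c → InF F x c × Sat σ′ (clause c)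
    into {c} (inj₁ c∈iz , c∈x) = c∈x , from (Sat-σ′ (clause c)) (inj₂ (proj₂ (to (sat-iz c) c∈iz)))
    into {c} (inj₂ c∈oy , c∈x) = c∈x , from (Sat-σ′ (clause c)) (inj₁ (proj₂ (to (sat-oy c) c∈oy)))

    back : ∀ {c} → InF F x c × Sat σ′ (clause c) → (c ∈ˢ iz ⊎ c ∈ˢ oy) × InF F x c
    back {c} (c∈x , sat) with to (Sat-σ′ (clause c)) sat
    ... | inj₁ sat-τy = inj₂ (from (sat-oy c) (clause-disjoint c c∈x , sat-τy)) , c∈x
    ... | inj₂ sat-σ  = inj₁ (from (sat-iz c) (clauseˡ c c∈x , sat-σ)) , c∈x

  Gen-productive : ∀ {z x y s sx sy} → Split z x y → Proper F z s → Gen F z x y s (sx , sy)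
    → count x sx * count y sy ≡ 0 ⊎ (Proper F x sx × Proper F y sy)
  Gen-productive {x = x} {y} {sx = sx} {sy} sp proper (_ , _ , _ , ix⇔ , iy⇔) with count x sx * count y sy ≟ 0
  ... | yes product≡0 = inj₁ product≡0
  ... | no product≢0
    with Count-nonzero (count-NCount x sx) (λ e → product≢0 (cong (_* count y sy) e))
       | Count-nonzero (count-NCount y sy) (λ e → product≢0 (trans (cong (count x sx *_) e) (*-zeroʳ (count x sx))))
  ... | τx , ofx | τy , ofy =
    inj₂ (Proper-child τx τy sp proper ix⇔ ofx ofy , Proper-child τy τx (Split-swap sp) proper iy⇔ ofy ofx)

  -- 𝒳↑_z and 𝒳↓_z are the cases (G , W) = (F̄_z , var_z) and (F_z , var̄_z).
  ClauseTrace : (Fin m → Set) → (Fin n → Set) → Subset n → Set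
  ClauseTrace G W X = ∃[ c ] (G c × (∀ v → (v ∈ˢ X ⇔ (W v × v ∈var clause c))))

  -- If τ witnesses S ∈ Proj(G, W), then X ↦ G^{⊇X}(τ|X) has union S.
  InProj⇒union : ∀ {G : Fin m → Set} {W : Fin n → Set} {S} → Decidable G → Decidable W → InProj F G W S
    → ∃[ f ] ((∀ X → ClauseTrace G W X → InProj F (Sup F G X) (λ v → v ∈ˢ X) (f X))
              × IsUnion F (ClauseTrace G W) f S)
  InProj⇒union {G} {W} {S} G? W? (τ , τ-on , sat-S) = f , f-proj , f-union
    where
    τ∣ : Subset n → PAssign n
    τ∣ X = restrict (_∈ˢ? X) τ

    f? : ∀ X → Decidable (λ c → Sup F G X c × Sat (τ∣ X) (clause c))
    f? X c = Sup? G? X c ×-dec Sat? (τ∣ X) (clause c)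

    f : Subset n → Subset m
    f X = ⁅ f? X ⁆

    f-proj : ∀ X → ClauseTrace G W X → InProj F (Sup F G X) (λ v → v ∈ˢ X) (f X)
    f-proj X (_ , _ , X⇔) =
      τ∣ X , IsAssignOn-restrict (_∈ˢ? X) (λ v v∈X → proj₁ (to (X⇔ v) v∈X)) τ τ-on , ∈⁅⁆ (f? X)

    f-union : IsUnion F (ClauseTrace G W) f S
    f-union c = mk⇔ into back
      where
      into : c ∈ˢ S → ∃[ X ] (ClauseTrace G W X × c ∈ˢ f X)
      into c∈S with to (sat-S c) c∈S
      ... | c∈G , (v , b , C∋ , τv) =
        X , (c , c∈G , ∈⁅⁆ trace?)
        , from (∈⁅⁆ (f? X) c) ((c∈G , λ u u∈X → proj₂ (to (∈⁅⁆ trace? u) u∈X))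
                              , Sat-restrict⁺ (_∈ˢ? X) τ (clause c) v b C∋ τv
                                  (from (∈⁅⁆ trace? v) (IsAssignOn-dom W? {τ} τ-on v b τv , b , C∋)))
        where
        trace? : Decidable (λ u → W u × u ∈var clause c)
        trace? u = W? u ×-dec (u ∈var? clause c)
        X : Subset n
        X = ⁅ trace? ⁆
      back : ∃[ X ] (ClauseTrace G W X × c ∈ˢ f X) → c ∈ˢ S
      back (X , _ , c∈fX) with to (∈⁅⁆ (f? X) c) c∈fX
      ... | (c∈G , _) , sat = from (sat-S c) (c∈G , Sat-restrict⁻ (_∈ˢ? X) τ (clause c) sat)

  Proper⇒InR : ∀ t s → IsShape F t s → Proper F t s → InR F t s
  Proper⇒InR t _ shape (out-proj , in-proj) =
    shape , InProj⇒union (InFC? t) (InVar? t) out-proj , InProj⇒union (InF? t) (InVarC? t) in-proj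

LowerBounding-≤ : ∀ {F t l} → LowerBounding F t l → ∀ s → InR F t s → l s ≤ count F t s
LowerBounding-≤ {F} {t} bound s s∈R = proj₁ (bound s s∈R) _ (count-NCount F t s)

LowerBounding-proper : ∀ {F t l} → LowerBounding F t l → ∀ s → InR F t s → Proper F t s → l s ≡ count F t s
LowerBounding-proper {F} {t} bound s s∈R proper = proj₂ (bound s s∈R) proper _ (count-NCount F t s)

*-squeeze-0 : ∀ {a b c d} → a ≤ c → b ≤ d → c * d ≡ 0 → a * b ≡ c * d
*-squeeze-0 {a} {b} a≤c b≤d cd≡0 = trans (n≤0⇒n≡0 (subst (a * b ≤_) cd≡0 (*-mono-≤ a≤c b≤d))) (sym cd≡0)

module _ {F : CNF} {z x y : Tree F} (split : Split F z x y) {lx ly : Shape F → ℕ}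
         (lx-bound : LowerBounding F x lx) (ly-bound : LowerBounding F y ly) where

  lx-≤ : ∀ sx → InR F x sx → lx sx ≤ count F x sx
  lx-≤ = LowerBounding-≤ {F} {x} {lx} lx-bound

  ly-≤ : ∀ sy → InR F y sy → ly sy ≤ count F y sy
  ly-≤ = LowerBounding-≤ {F} {y} {ly} ly-bound

  RGenSum : Shape F → ℕ → Set
  RGenSum s = SumOver (InRGen F z x y s) (λ p → lx (proj₁ p) * ly (proj₂ p)) (allShapePairs F)

  RGenSum-≤ : ∀ s {r} → RGenSum s r → r ≤ count F z s
  RGenSum-≤ s sum = SumOver-mono-≤ sum (count-node F split s) term-≤
    where
    term-≤ : ∀ p → InRGen F z x y s p
           → Gen F z x y s p × lx (proj₁ p) * ly (proj₂ p) ≤ count F x (proj₁ p) * count F y (proj₂ p)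
    term-≤ (sx , sy) (gen , sx∈R , sy∈R) = gen , *-mono-≤ (lx-≤ sx sx∈R) (ly-≤ sy sy∈R)

  RGenSum-proper : ∀ s → Proper F z s → ∀ {r} → RGenSum s r → r ≡ count F z s
  RGenSum-proper s proper sum = SumOver-cong sum (count-node F split s) term-≡ vanish
    where
    term-≡ : ∀ p → InRGen F z x y s p
           → Gen F z x y s p × lx (proj₁ p) * ly (proj₂ p) ≡ count F x (proj₁ p) * count F y (proj₂ p)
    term-≡ (sx , sy) (gen , sx∈R , sy∈R) = gen , [ *-squeeze-0 (lx-≤ sx sx∈R) (ly-≤ sy sy∈R) ,
      (λ (sx-proper , sy-proper) → cong₂ _*_ (LowerBounding-proper {F} {x} {lx} lx-bound sx sx∈R sx-proper)
                                             (LowerBounding-proper {F} {y} {ly} ly-bound sy sy∈R sy-proper)) ]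
      (Gen-productive F split proper gen)

    vanish : ∀ p → Gen F z x y s p → ¬ InRGen F z x y s p → count F x (proj₁ p) * count F y (proj₂ p) ≡ 0
    vanish (sx , sy) gen@(sx-shape , sy-shape , _) ∉RGen = [ (λ product≡0 → product≡0) ,
      (λ (sx-proper , sy-proper) → ⊥-elim (∉RGen (gen , Proper⇒InR F x sx sx-shape sx-proper
                                                       , Proper⇒InR F y sy sy-shape sy-proper))) ]
      (Gen-productive F split proper gen)

lemma9 : (F : CNF) (T : Tree F) → IsDecompTree F T
    → (x y : Tree F) → node x y ⊑ T
    → (lx ly lz : Shape F → ℕ)
    → LowerBounding F x lx → LowerBounding F y ly
    → (∀ s → InR F (node x y) s
         → SumOver (InRGen F (node x y) x y s) (λ p → lx (proj₁ p) * ly (proj₂ p))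
             (allShapePairs F) (lz s))
    → LowerBounding F (node x y) lz
lemma9 F T decomposition x y x∙y⊑T lx ly lz lx-bound ly-bound lz-sum s s∈R =
  (λ k k-count → subst (lz s ≤_) (count≡ k-count) (RGenSum-≤ split lx-bound ly-bound s (lz-sum s s∈R))) ,
  (λ proper k k-count →
     trans (RGenSum-proper split lx-bound ly-bound s proper (lz-sum s s∈R)) (count≡ k-count))
  where
  split : Split F (node x y) x y
  split = node-Split F decomposition x∙y⊑T
  count≡ : ∀ {k} → NCount F (node x y) s k → count F (node x y) s ≡ k
  count≡ = SumOver-unique (count-NCount F (node x y) s)
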